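{- If a $vgr(v,k,g,\lambda)$-graph exists, then there exist infinitely many integers $v'$ such that a $vgr(v',k+1,g,\lambda)$-graph exists.
   Context: A $vgr(v,k,g,\lambda)$-graph is a $k$-regular graph of girth $g$ on $v$ vertices in which every vertex is contained in exactly $\lambda$ cycles of length $g$. -}

module Defs where

open import Data.Nat using (ℕ; zero; suc; _≤_; _<ᵇ_; _≡ᵇ_)
open import Data.Bool using (Bool; true; false; _∧_; not; T)
open import Data.Fin using (Fin; toℕ)
open import Data.List using (List; []; _∷_; [_]; length; map; concatMap; allFin)
open import Data.Product using (Σ; _×_)
open import Relation.Binary.PropositionalEquality using (_≡_)

record Graph (n : ℕ) : Set where
  field
    adj    : Fin n → Fin n → Bool
    sym    : ∀ i j → adj i j ≡ adj j i
    irrefl : ∀ i → adj i i ≡ false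
open Graph public

countᵇ : {A : Set} → (A → Bool) → List A → ℕ
countᵇ p [] = 0
countᵇ p (x ∷ xs) with p x
... | true  = suc (countᵇ p xs)
... | false = countᵇ p xs

anyᵇ : {A : Set} → (A → Bool) → List A → Bool
anyᵇ p [] = false
anyᵇ p (x ∷ xs) with p x
... | true  = true
... | false = anyᵇ p xs

allᵇ : {A : Set} → (A → Bool) → List A → Bool
allᵇ p [] = true
allᵇ p (x ∷ xs) = p x ∧ allᵇ p xs

_==_ : {n : ℕ} → Fin n → Fin n → Bool
i == j = toℕ i ≡ᵇ toℕ j

degree : {n : ℕ} → Graph n → Fin n → ℕ
degree {n} G i = countᵇ (adj G i) (allFin n)

Regular : {n : ℕ} → Graph n → ℕ → Set
Regular {n} G k = ∀ (i : Fin n) → degree G i ≡ k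

distinctᵇ : {n : ℕ} → List (Fin n) → Bool
distinctᵇ [] = true
distinctᵇ (x ∷ xs) = not (anyᵇ (x ==_) xs) ∧ distinctᵇ xs

walkTo : {n : ℕ} → Graph n → Fin n → List (Fin n) → Bool
walkTo G first [] = false
walkTo G first (y ∷ []) = adj G y first
walkTo G first (y ∷ z ∷ zs) = adj G y z ∧ walkTo G first (z ∷ zs)

isCycleᵇ : {n : ℕ} → Graph n → List (Fin n) → Bool
isCycleᵇ G [] = false
isCycleᵇ G (_ ∷ []) = false
isCycleᵇ G (_ ∷ _ ∷ []) = false
isCycleᵇ G (x ∷ y ∷ z ∷ zs) =
  distinctᵇ (x ∷ y ∷ z ∷ zs) ∧ walkTo G x (x ∷ y ∷ z ∷ zs)

lastOf : {A : Set} → A → List A → A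
lastOf z [] = z
lastOf z (w ∷ ws) = lastOf w ws

-- Each cycle (as a subgraph) of length ≥ 3 has exactly one "canonical"
-- vertex sequence: it starts at its smallest vertex, and the second
-- vertex is smaller than the last one (fixing the orientation).
canonicalᵇ : {n : ℕ} → List (Fin n) → Bool
canonicalᵇ (x ∷ y ∷ z ∷ zs) =
  allᵇ (λ w → toℕ x <ᵇ toℕ w) (y ∷ z ∷ zs) ∧ (toℕ y <ᵇ toℕ (lastOf z zs))
canonicalᵇ _ = false

allLists : (n l : ℕ) → List (List (Fin n))
allLists n zero = [ [] ]
allLists n (suc l) = concatMap (λ x → map (x ∷_) (allLists n l)) (allFin n)

cyclesThrough : {n : ℕ} → Graph n → ℕ → Fin n → ℕ
cyclesThrough {n} G l x =
  countᵇ (λ c → isCycleᵇ G c ∧ canonicalᵇ c ∧ anyᵇ (x ==_) c) (allLists n l)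

HasGirth : {n : ℕ} → Graph n → ℕ → Set
HasGirth {n} G g =
  (Σ (List (Fin n)) λ c → length c ≡ g × T (isCycleᵇ G c))
  × (∀ (c : List (Fin n)) → T (isCycleᵇ G c) → g ≤ length c)

VGR : (v k g lam : ℕ) → Set
VGR v k g lam =
  Σ (Graph v) λ G → Regular G k × HasGirth G g × (∀ (x : Fin v) → cyclesThrough G g x ≡ lam)

{-# OPTIONS --safe #-}
-- Take m copies of G and join vertex x of copy i to vertex x of copy σ x i, where
-- every σ x is a fixed-point-free involution of Fin m; the result is (k+1)-regular.
-- Along a cycle that leaves its copy the matching edges spell a nonempty reduced word
-- in the σ x fixing the starting copy, so if all such words are longer than g, the
-- cycles of length at most g are exactly the copies of cycles of G: girth and λ are
-- preserved.
-- Involutions with arbitrarily long relations on arbitrarily large sets come from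
-- iterating a Z₂-cover that adds one to the length of the shortest relation.
module Submission where

open import Defs hiding (sym)
open import Data.Bool using (Bool; true; false; _∧_; not; T; if_then_else_)
open import Data.Bool.Properties using (T-∧; T-≡; not-involutive; not-¬)
open import Data.Empty using (⊥-elim)
open import Data.Fin using (Fin; zero; suc; toℕ; combine; remQuot; _↑ˡ_; _↑ʳ_; fromℕ<)
open import Data.Fin.Properties
  using (toℕ-injective; suc-injective; toℕ-combine; combine-injective; remQuot-combine; combine-remQuot;
         2↔Bool; *↔×)
open import Data.List using (List; []; _∷_; [_]; _++_; length; map; tabulate; concatMap; foldl)
open import Data.List.Properties using (foldl-++; ++-assoc; length-++; length-map)
open import Data.List.Membership.Propositional using (_∈_)
open import Data.List.Relation.Unary.All as All using (All; []; _∷_)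
open import Data.List.Relation.Unary.All.Properties using (¬Any⇒All¬; All¬⇒¬Any; ++⁻ˡ; concat⁺; map⁺; tabulate⁺)
open import Data.List.Relation.Unary.AllPairs using ([]; _∷_)
open import Data.List.Relation.Unary.Any using (Any; here; there)
open import Data.List.Relation.Unary.Linked as Linked using (Linked; []; [-]; _∷_)
open import Data.List.Relation.Unary.Unique.Propositional using (Unique)
import Data.List.Relation.Unary.Unique.Propositional.Properties as Unique
open import Data.Nat using (ℕ; zero; suc; _+_; _*_; _^_; _≤_; _<_; z≤n; s≤s; z<s; _≡ᵇ_; _<ᵇ_; >-nonZero)
open import Data.Nat.Properties
  using (≡ᵇ⇒≡; ≡⇒≡ᵇ; +-0-commutativeMonoid; +-identityʳ; +-assoc; +-comm; ≤-trans; <-≤-trans; ≤-<-trans;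
         <⇒≤; <⇒≱; ≤∧≢⇒<; m≤n⇒m≤1+n; m≤m+n; m≤n+m; m≤m*n; m<m*n; ^-monoʳ-<)
open import Algebra.Properties.CommutativeMonoid.Sum +-0-commutativeMonoid
  using (sum; sum-cong-≗; sum-replicate-zero; ∑-distrib-+)
open import Data.Product using (Σ; _×_; _,_; proj₁; proj₂; uncurry)
open import Data.Product.Function.NonDependent.Propositional using (_×-↔_)
open import Data.Sum as Sum using (_⊎_; inj₁; inj₂)
open import Data.Unit using (tt)
open import Data.Vec using (Vec; []; _∷_; lookup; updateAt; uncons)
open import Data.Vec.Properties using (updateAt-updateAt; updateAt-id-local; lookup∘updateAt; lookup∘updateAt′)
open import Function using (_∘_; id; Equivalence; Inverse; _↔_; mk↔ₛ′)
open import Function.Properties.Inverse using (↔-refl; ↔-sym; ↔-trans)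
open import Relation.Nullary using (¬_)
open import Relation.Nullary.Reflects using (Reflects; ofʸ; ofⁿ; fromEquivalence; _×-reflects_)
open import Relation.Binary.PropositionalEquality
  using (_≡_; _≢_; refl; sym; trans; cong; cong₂; subst; module ≡-Reasoning)

reflects⇒ : ∀ {P : Set} {b} → Reflects P b → T b → P
reflects⇒ (ofʸ p) _ = p

T-∧⁻ : ∀ a {b} → T (a ∧ b) → T a × T b
T-∧⁻ a = Equivalence.to (T-∧ {a})

==-reflects : ∀ {n} (i j : Fin n) → Reflects (i ≡ j) (i == j)
==-reflects i j = fromEquivalence (toℕ-injective ∘ ≡ᵇ⇒≡ _ _) (≡⇒≡ᵇ _ _ ∘ cong toℕ)

==-refl : ∀ {n} (i : Fin n) → (i == i) ≡ true
==-refl i = Equivalence.to T-≡ (≡⇒≡ᵇ (toℕ i) (toℕ i) refl)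

==-≢ : ∀ {n} {i j : Fin n} → i ≢ j → (i == j) ≡ false
==-≢ {i = i} {j} i≢j with i == j | ==-reflects i j
... | true  | ofʸ i≡j = ⊥-elim (i≢j i≡j)
... | false | _       = refl

reflects-≡ : ∀ {P Q : Set} {a b} → Reflects P a → Reflects Q b → (P → Q) → (Q → P) → a ≡ b
reflects-≡ (ofʸ p) (ofʸ q) _ _ = refl
reflects-≡ (ofʸ p) (ofⁿ ¬q) P⇒Q _ = ⊥-elim (¬q (P⇒Q p))
reflects-≡ (ofⁿ ¬p) (ofʸ q) _ Q⇒P = ⊥-elim (¬p (Q⇒P q))
reflects-≡ (ofⁿ ¬p) (ofⁿ ¬q) _ _ = refl

==-sym : ∀ {n} (i j : Fin n) → (i == j) ≡ (j == i)
==-sym i j = reflects-≡ (==-reflects i j) (==-reflects j i) sym sym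

anyᵇ-reflects : {A : Set} {P : A → Set} {p : A → Bool} →
  (∀ x → Reflects (P x) (p x)) → ∀ xs → Reflects (Any P xs) (anyᵇ p xs)
anyᵇ-reflects r [] = ofⁿ λ ()
anyᵇ-reflects {p = p} r (x ∷ xs) with p x | r x
... | true  | ofʸ px = ofʸ (here px)
... | false | ofⁿ ¬px with anyᵇ p xs | anyᵇ-reflects r xs
...   | true  | ofʸ pxs = ofʸ (there pxs)
...   | false | ofⁿ ¬pxs = ofⁿ λ { (here px) → ¬px px ; (there pxs) → ¬pxs pxs }

∈-reflects : ∀ {n} (x : Fin n) xs → Reflects (x ∈ xs) (anyᵇ (x ==_) xs)
∈-reflects x = anyᵇ-reflects (==-reflects x)

+-≡ᵇ : ∀ k a b → (k + a ≡ᵇ k + b) ≡ (a ≡ᵇ b)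
+-≡ᵇ zero a b = refl
+-≡ᵇ (suc k) a b = +-≡ᵇ k a b

+-<ᵇ : ∀ k a b → (k + a <ᵇ k + b) ≡ (a <ᵇ b)
+-<ᵇ zero a b = refl
+-<ᵇ (suc k) a b = +-<ᵇ k a b

anyᵇ-map : ∀ {A B : Set} {p : B → Bool} {q : A → Bool} (f : A → B) →
  (∀ x → p (f x) ≡ q x) → ∀ xs → anyᵇ p (map f xs) ≡ anyᵇ q xs
anyᵇ-map f p≗q [] = refl
anyᵇ-map {p = p} {q} f p≗q (x ∷ xs) rewrite p≗q x with q x
... | true  = refl
... | false = anyᵇ-map f p≗q xs

allᵇ-map : ∀ {A B : Set} {p : B → Bool} {q : A → Bool} (f : A → B) →
  (∀ x → p (f x) ≡ q x) → ∀ xs → allᵇ p (map f xs) ≡ allᵇ q xs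
allᵇ-map f p≗q [] = refl
allᵇ-map f p≗q (x ∷ xs) = cong₂ _∧_ (p≗q x) (allᵇ-map f p≗q xs)

Linked-++⁻ˡ : ∀ {A : Set} {R : A → A → Set} xs {ys} → Linked R (xs ++ ys) → Linked R xs
Linked-++⁻ˡ [] _ = []
Linked-++⁻ˡ (x ∷ []) _ = [-]
Linked-++⁻ˡ (x ∷ y ∷ xs) (r ∷ rs) = r ∷ Linked-++⁻ˡ (y ∷ xs) rs

length-<-++∷ : ∀ {A : Set} (xs : List A) {y ys} → length xs < length (xs ++ y ∷ ys)
length-<-++∷ [] = s≤s z≤n
length-<-++∷ (x ∷ xs) = s≤s (length-<-++∷ xs)

lastOf-++ : ∀ {A : Set} (z : A) xs a → lastOf z (xs ++ [ a ]) ≡ a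
lastOf-++ z [] a = refl
lastOf-++ z (x ∷ xs) a = lastOf-++ x xs a

length-++-[_] : ∀ {A : Set} a (xs : List A) → length (xs ++ [ a ]) ≡ suc (length xs)
length-++-[ a ] xs = trans (length-++ xs) (+-comm (length xs) 1)

Unique-rotate : ∀ {A : Set} {a : A} {r} → Unique (a ∷ r) → Unique (r ++ [ a ])
Unique-rotate (a∉r ∷ u) = Unique.++⁺ u ([] ∷ []) λ { (a∈r , here refl) → All¬⇒¬Any a∉r a∈r }

distinctᵇ⇒Unique : ∀ {n} (xs : List (Fin n)) → T (distinctᵇ xs) → Unique xs
distinctᵇ⇒Unique [] _ = []
distinctᵇ⇒Unique (x ∷ xs) t with anyᵇ (x ==_) xs | ∈-reflects x xs
... | false | ofⁿ x∉xs = ¬Any⇒All¬ xs x∉xs ∷ distinctᵇ⇒Unique xs t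

Walk : ∀ {n} → Graph n → List (Fin n) → Set
Walk H = Linked (λ a b → T (adj H a b))

walkTo⇒Walk : ∀ {n} (H : Graph n) f y ys → T (walkTo H f (y ∷ ys)) → Walk H (y ∷ ys ++ [ f ])
walkTo⇒Walk H f y [] t = t ∷ [-]
walkTo⇒Walk H f y (z ∷ zs) t with T-∧⁻ (adj H y z) t
... | yz , rest = yz ∷ walkTo⇒Walk H f z zs rest

cycle⇒Unique : ∀ {n} (H : Graph n) c → T (isCycleᵇ H c) → Unique c
cycle⇒Unique H c@(_ ∷ _ ∷ _ ∷ _) t = distinctᵇ⇒Unique c (proj₁ (T-∧⁻ (distinctᵇ c) t))

cycle⇒Walk : ∀ {n} (H : Graph n) x xs → T (isCycleᵇ H (x ∷ xs)) → Walk H (x ∷ xs ++ [ x ])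
cycle⇒Walk H x xs@(_ ∷ _ ∷ _) t = walkTo⇒Walk H x x xs (proj₂ (T-∧⁻ (distinctᵇ (x ∷ xs)) t))

cycleThroughᵇ : ∀ {n} → Graph n → Fin n → List (Fin n) → Bool
cycleThroughᵇ H x c = isCycleᵇ H c ∧ canonicalᵇ c ∧ anyᵇ (x ==_) c

cycleThrough⇒isCycle : ∀ {n} (H : Graph n) x c → T (cycleThroughᵇ H x c) → T (isCycleᵇ H c)
cycleThrough⇒isCycle H x c t = proj₁ (T-∧⁻ (isCycleᵇ H c) t)

cycleThrough⇒∈ : ∀ {n} (H : Graph n) x c → T (cycleThroughᵇ H x c) → x ∈ c
cycleThrough⇒∈ H x c t = reflects⇒ (∈-reflects x c)
  (proj₂ (T-∧⁻ (canonicalᵇ c) (proj₂ (T-∧⁻ (isCycleᵇ H c) t))))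

hasGirth⇒0< : ∀ {n g} {H : Graph n} → HasGirth H g → 0 < n
hasGirth⇒0< {suc n} _ = z<s
hasGirth⇒0< {zero} (((() ∷ _) , _) , _)

-- The cycle predicates compare vertices through toℕ, so φ has to translate indices.
module Embedding {v n : ℕ} {G : Graph v} {H : Graph n} (φ : Fin v → Fin n) (offset : ℕ)
                 (toℕ-φ : ∀ x → toℕ (φ x) ≡ offset + toℕ x)
                 (adj-φ : ∀ x y → adj H (φ x) (φ y) ≡ adj G x y) where

  ==-φ : ∀ x y → (φ x == φ y) ≡ (x == y)
  ==-φ x y = trans (cong₂ _≡ᵇ_ (toℕ-φ x) (toℕ-φ y)) (+-≡ᵇ offset (toℕ x) (toℕ y))

  <ᵇ-φ : ∀ x y → (toℕ (φ x) <ᵇ toℕ (φ y)) ≡ (toℕ x <ᵇ toℕ y)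
  <ᵇ-φ x y = trans (cong₂ _<ᵇ_ (toℕ-φ x) (toℕ-φ y)) (+-<ᵇ offset (toℕ x) (toℕ y))

  walkTo-φ : ∀ f xs → walkTo H (φ f) (map φ xs) ≡ walkTo G f xs
  walkTo-φ f [] = refl
  walkTo-φ f (y ∷ []) = adj-φ y f
  walkTo-φ f (y ∷ z ∷ zs) = cong₂ _∧_ (adj-φ y z) (walkTo-φ f (z ∷ zs))

  distinctᵇ-φ : ∀ xs → distinctᵇ (map φ xs) ≡ distinctᵇ xs
  distinctᵇ-φ [] = refl
  distinctᵇ-φ (x ∷ xs) = cong₂ _∧_ (cong not (anyᵇ-map φ (==-φ x) xs)) (distinctᵇ-φ xs)

  lastOf-φ : ∀ z zs → lastOf (φ z) (map φ zs) ≡ φ (lastOf z zs)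
  lastOf-φ z [] = refl
  lastOf-φ z (w ∷ ws) = lastOf-φ w ws

  isCycleᵇ-φ : ∀ c → isCycleᵇ H (map φ c) ≡ isCycleᵇ G c
  isCycleᵇ-φ [] = refl
  isCycleᵇ-φ (_ ∷ []) = refl
  isCycleᵇ-φ (_ ∷ _ ∷ []) = refl
  isCycleᵇ-φ c@(x ∷ _ ∷ _ ∷ _) = cong₂ _∧_ (distinctᵇ-φ c) (walkTo-φ x c)

  canonicalᵇ-φ : ∀ c → canonicalᵇ (map φ c) ≡ canonicalᵇ c
  canonicalᵇ-φ [] = refl
  canonicalᵇ-φ (_ ∷ []) = refl
  canonicalᵇ-φ (_ ∷ _ ∷ []) = refl
  canonicalᵇ-φ (x ∷ y ∷ z ∷ zs) = cong₂ _∧_ (allᵇ-map {p = λ w → toℕ (φ x) <ᵇ toℕ w} φ (<ᵇ-φ x) (y ∷ z ∷ zs))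
    (trans (cong (λ w → toℕ (φ y) <ᵇ toℕ w) (lastOf-φ z zs)) (<ᵇ-φ y (lastOf z zs)))

  cycleThroughᵇ-φ : ∀ x c → cycleThroughᵇ H (φ x) (map φ c) ≡ cycleThroughᵇ G x c
  cycleThroughᵇ-φ x c = cong₂ _∧_ (isCycleᵇ-φ c) (cong₂ _∧_ (canonicalᵇ-φ c) (anyᵇ-map φ (==-φ x) c))

ind : Bool → ℕ
ind b = if b then 1 else 0

indicator : ∀ {n} → Fin n → ℕ → Fin n → ℕ
indicator i c j = if i == j then c else 0

sum-zero : ∀ {n} {f : Fin n → ℕ} → (∀ i → f i ≡ 0) → sum f ≡ 0
sum-zero {n} f≗0 = trans (sum-cong-≗ f≗0) (sum-replicate-zero n)

sum-single : ∀ {n} {f : Fin n → ℕ} i → (∀ j → j ≢ i → f j ≡ 0) → sum f ≡ f i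
sum-single {suc n} {f} zero f≗0 =
  trans (cong (f zero +_) (sum-zero (λ j → f≗0 (suc j) λ ()))) (+-identityʳ (f zero))
sum-single {suc n} {f} (suc i) f≗0 =
  cong₂ _+_ (f≗0 zero λ ()) (sum-single i (λ j j≢i → f≗0 (suc j) (j≢i ∘ suc-injective)))

sum-indicator : ∀ {n} (i : Fin n) c → sum (indicator i c) ≡ c
sum-indicator i c = trans (sum-single i λ j j≢i → cong (if_then c else 0) (==-≢ (j≢i ∘ sym)))
                          (cong (if_then c else 0) (==-refl i))

sum-++ : ∀ m {n} (f : Fin (m + n) → ℕ) → sum f ≡ sum {m} (λ i → f (i ↑ˡ n)) + sum {n} (λ j → f (m ↑ʳ j))
sum-++ zero f = refl
sum-++ (suc m) f = trans (cong (f zero +_) (sum-++ m (f ∘ suc))) (sym (+-assoc (f zero) _ _))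

sum-combine : ∀ m {n} (f : Fin (m * n) → ℕ) → sum f ≡ sum {m} (λ i → sum {n} (λ j → f (combine i j)))
sum-combine zero f = refl
sum-combine (suc m) {n} f =
  trans (sum-++ n {m * n} f) (cong (sum (λ j → f (j ↑ˡ (m * n))) +_) (sum-combine m (λ k → f (n ↑ʳ k))))

countᵇ-++ : ∀ {A : Set} (p : A → Bool) xs ys → countᵇ p (xs ++ ys) ≡ countᵇ p xs + countᵇ p ys
countᵇ-++ p [] ys = refl
countᵇ-++ p (x ∷ xs) ys with p x
... | true  = cong suc (countᵇ-++ p xs ys)
... | false = countᵇ-++ p xs ys

countᵇ-tabulate : ∀ {A : Set} {n} (p : A → Bool) (f : Fin n → A) →
  countᵇ p (tabulate f) ≡ sum (λ i → ind (p (f i)))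
countᵇ-tabulate {n = zero} p f = refl
countᵇ-tabulate {n = suc n} p f with p (f zero)
... | true  = cong suc (countᵇ-tabulate p (f ∘ suc))
... | false = countᵇ-tabulate p (f ∘ suc)

countᵇ-concatMap-tabulate : ∀ {A B : Set} {n} (p : B → Bool) (h : A → List B) (f : Fin n → A) →
  countᵇ p (concatMap h (tabulate f)) ≡ sum (λ i → countᵇ p (h (f i)))
countᵇ-concatMap-tabulate {n = zero} p h f = refl
countᵇ-concatMap-tabulate {n = suc n} p h f =
  trans (countᵇ-++ p (h (f zero)) _) (cong (countᵇ p (h (f zero)) +_) (countᵇ-concatMap-tabulate p h (f ∘ suc)))

countᵇ-map : ∀ {A B : Set} (p : B → Bool) (f : A → B) xs → countᵇ p (map f xs) ≡ countᵇ (p ∘ f) xs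
countᵇ-map p f [] = refl
countᵇ-map p f (x ∷ xs) with p (f x)
... | true  = cong suc (countᵇ-map p f xs)
... | false = countᵇ-map p f xs

countᵇ-none : ∀ {A : Set} {p : A → Bool} {xs} → All (λ x → ¬ T (p x)) xs → countᵇ p xs ≡ 0
countᵇ-none [] = refl
countᵇ-none {p = p} {x ∷ _} (¬px ∷ ¬pxs) with p x
... | true  = ⊥-elim (¬px tt)
... | false = countᵇ-none ¬pxs

countᵇ-cong : ∀ {A : Set} {p q : A → Bool} → (∀ x → p x ≡ q x) → ∀ xs → countᵇ p xs ≡ countᵇ q xs
countᵇ-cong p≗q [] = refl
countᵇ-cong {p = p} {q} p≗q (x ∷ xs) rewrite p≗q x with q x
... | true  = cong suc (countᵇ-cong p≗q xs)
... | false = countᵇ-cong p≗q xs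

allLists-length : ∀ n l → All (λ c → length c ≡ l) (allLists n l)
allLists-length n zero = refl ∷ []
allLists-length n (suc l) = concat⁺ (map⁺ (tabulate⁺ {f = id} λ x →
  map⁺ {f = x ∷_} (All.map (cong suc) (allLists-length n l))))

-- Matchings without short closed reduced walks

act : ∀ {v} {A : Set} → (Fin v → A → A) → List (Fin v) → A → A
act σ w i = foldl (λ j x → σ x j) i w

act-++ : ∀ {v} {A : Set} (σ : Fin v → A → A) ws ys i → act σ (ws ++ ys) i ≡ act σ ys (act σ ws i)
act-++ σ ws ys i = foldl-++ (λ j x → σ x j) i ws ys

-- Each σ x is a perfect matching of A, of colour x.  Following the colours of w from i
-- is a walk in their union, non-backtracking exactly when w is reduced (Linked _≢_).
record Matchings (v : ℕ) (A : Set) (L : ℕ) : Set where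
  field
    σ : Fin v → A → A
    σ-involutive : ∀ x i → σ x (σ x i) ≡ i
    σ-fixpointFree : ∀ x i → σ x i ≢ i
    closed⇒long : ∀ {x w i} → Linked _≢_ (x ∷ w) → act σ (x ∷ w) i ≡ i → L ≤ length (x ∷ w)

  short⇒open : ∀ {x w i} → Linked _≢_ (x ∷ w) → length (x ∷ w) < L → act σ (x ∷ w) i ≢ i
  short⇒open r short closed = <⇒≱ short (closed⇒long r closed)

swaps : ∀ {v} → Matchings v (Fin 2) 1
swaps = record
  { σ = λ _ → swap
  ; σ-involutive = λ _ → swap-involutive
  ; σ-fixpointFree = λ _ → swap-fixpointFree
  ; closed⇒long = λ _ _ → s≤s z≤n
  }
  where
  swap : Fin 2 → Fin 2
  swap zero = suc zero
  swap (suc zero) = zero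
  swap-involutive : ∀ i → swap (swap i) ≡ i
  swap-involutive zero = refl
  swap-involutive (suc zero) = refl
  swap-fixpointFree : ∀ i → swap i ≢ i
  swap-fixpointFree zero ()
  swap-fixpointFree (suc zero) ()

transport : ∀ {v L} {A B : Set} → A ↔ B → Matchings v A L → Matchings v B L
transport {v} {L} {A} {B} A↔B M = record
  { σ = σ′
  ; σ-involutive = λ x b → begin
      to (σ x (from (to (σ x (from b))))) ≡⟨ cong (to ∘ σ x) (strictlyInverseʳ _) ⟩
      to (σ x (σ x (from b)))             ≡⟨ cong to (σ-involutive x (from b)) ⟩
      to (from b)                         ≡⟨ strictlyInverseˡ b ⟩
      b                                   ∎
  ; σ-fixpointFree = λ x b fixed → σ-fixpointFree x (from b) (fromFixed fixed)
  ; closed⇒long = λ {x} {w} {b} r closed → closed⇒long r (fromFixed (trans (sym (act-σ′ (x ∷ w) b)) closed))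
  }
  where
  open Matchings M
  open Inverse A↔B
  open ≡-Reasoning
  σ′ : Fin v → B → B
  σ′ x = to ∘ σ x ∘ from
  fromFixed : ∀ {a b} → to a ≡ b → a ≡ from b
  fromFixed {a} refl = sym (strictlyInverseʳ a)
  act-σ′ : ∀ w b → act σ′ w b ≡ to (act σ w (from b))
  act-σ′ [] b = sym (strictlyInverseˡ b)
  act-σ′ (x ∷ w) b = trans (act-σ′ w (σ′ x b)) (cong (λ a → to (act σ w a)) (strictlyInverseʳ _))

toggle : ∀ {d} → Fin d → Vec Bool d → Vec Bool d
toggle k s = updateAt s k not

toggle-involutive : ∀ {d} (k : Fin d) s → toggle k (toggle k s) ≡ s
toggle-involutive k s = trans (updateAt-updateAt k s) (updateAt-id-local k s (not-involutive _))

lookup-toggle-toggle : ∀ {d} {k a b : Fin d} → a ≢ k → b ≢ k → ∀ s →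
  lookup (toggle a (toggle b s)) k ≡ lookup s k
lookup-toggle-toggle {k = k} {a} {b} a≢k b≢k s =
  trans (lookup∘updateAt′ k a (a≢k ∘ sym) (toggle b s)) (lookup∘updateAt′ k b (b≢k ∘ sym) s)

-- ℓ labels the darts (x , i) injectively by bits.  A reduced walk of length exactly L
-- meets its first dart (x , i) only once, so its lift toggles that bit and is not closed.
module Lift {v d L : ℕ} {A : Set} (M : Matchings v A L) (ℓ : Fin v → A → Fin d)
            (ℓ-injective : ∀ {x y i j} → ℓ x i ≡ ℓ y j → x ≡ y × i ≡ j) where

  open Matchings M

  σ̂ : Fin v → A × Vec Bool d → A × Vec Bool d
  σ̂ x (i , s) = σ x i , toggle (ℓ x (σ x i)) (toggle (ℓ x i) s)

  σ̂-involutive : ∀ x p → σ̂ x (σ̂ x p) ≡ p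
  σ̂-involutive x (i , s) rewrite σ-involutive x i =
    cong (i ,_) (trans (cong (toggle (ℓ x i)) (toggle-involutive (ℓ x (σ x i)) _)) (toggle-involutive (ℓ x i) s))

  proj₁-act : ∀ w p → proj₁ (act σ̂ w p) ≡ act σ w (proj₁ p)
  proj₁-act [] p = refl
  proj₁-act (x ∷ w) (i , s) = proj₁-act w (σ̂ x (i , s))

  Avoids : Fin d → Fin v → A → Set
  Avoids k y j = ℓ y j ≢ k × ℓ y (σ y j) ≢ k

  lookup-act : ∀ w {j s k} → (∀ pre y suf → w ≡ pre ++ y ∷ suf → Avoids k y (act σ pre j)) →
    lookup (proj₂ (act σ̂ w (j , s))) k ≡ lookup s k
  lookup-act [] avoids = refl
  lookup-act (y ∷ w) {j} {s} avoids =
    trans (lookup-act w (λ pre z suf w≡ → avoids (y ∷ pre) z suf (cong (y ∷_) w≡)))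
          (lookup-toggle-toggle (proj₂ first) (proj₁ first) s)
    where first = avoids [] y w refl

  module _ {x : Fin v} {ws : List (Fin v)} {i : A}
           (reduced : Linked _≢_ (x ∷ ws)) (length≡L : length (x ∷ ws) ≡ L) where

    prefix-open : ∀ pre y suf → ws ≡ pre ++ y ∷ suf → act σ (x ∷ pre) i ≢ i
    prefix-open pre y suf refl = short⇒open (Linked-++⁻ˡ (x ∷ pre) reduced)
      (subst (length (x ∷ pre) <_) length≡L (s≤s (length-<-++∷ pre)))

    last-open : ∀ pre → ws ≡ pre ++ [ x ] → act σ pre (σ x i) ≢ σ x i
    last-open [] refl fixed = Linked.head reduced refl
    last-open (z ∷ pre) refl = short⇒open (Linked-++⁻ˡ (z ∷ pre) (Linked.tail reduced))
      (subst (length (z ∷ pre) <_) length≡L (m≤n⇒m≤1+n (length-<-++∷ (z ∷ pre))))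

    -- If a later step ends at i along colour x, then either a proper prefix is already
    -- closed, or it is the last step and the middle of the word is closed at σ x i.
    far-dart-avoids : ∀ pre y suf → ws ≡ pre ++ y ∷ suf → ℓ y (σ y (act σ pre (σ x i))) ≢ ℓ x i
    far-dart-avoids pre y suf ws≡ eq with ℓ-injective eq
    far-dart-avoids pre y [] ws≡ eq | refl , returns =
      last-open pre ws≡ (trans (sym (σ-involutive x _)) (cong (σ x) returns))
    far-dart-avoids pre y (z ∷ suf) ws≡ eq | refl , returns =
      prefix-open (pre ++ [ x ]) z suf (trans ws≡ (sym (++-assoc pre [ x ] (z ∷ suf))))
        (trans (act-++ σ (x ∷ pre) [ x ] i) returns)

    avoids-first : ∀ pre y suf → ws ≡ pre ++ y ∷ suf → Avoids (ℓ x i) y (act σ pre (σ x i))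
    avoids-first pre y suf ws≡ =
      (λ eq → prefix-open pre y suf ws≡ (proj₂ (ℓ-injective eq))) , far-dart-avoids pre y suf ws≡

    toggles-first : ∀ s → lookup (proj₂ (act σ̂ (x ∷ ws) (i , s))) (ℓ x i) ≡ not (lookup s (ℓ x i))
    toggles-first s = begin
      lookup (proj₂ (act σ̂ ws (σ̂ x (i , s)))) (ℓ x i)
        ≡⟨ lookup-act ws avoids-first ⟩
      lookup (toggle (ℓ x (σ x i)) (toggle (ℓ x i) s)) (ℓ x i)
        ≡⟨ lookup∘updateAt′ (ℓ x i) (ℓ x (σ x i)) other-dart (toggle (ℓ x i) s) ⟩
      lookup (toggle (ℓ x i) s) (ℓ x i)
        ≡⟨ lookup∘updateAt (ℓ x i) s ⟩
      not (lookup s (ℓ x i)) ∎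
      where
      open ≡-Reasoning
      other-dart : ℓ x i ≢ ℓ x (σ x i)
      other-dart eq = σ-fixpointFree x i (sym (proj₂ (ℓ-injective eq)))

  lifted-closed⇒long : ∀ {x w p} → Linked _≢_ (x ∷ w) → act σ̂ (x ∷ w) p ≡ p → suc L ≤ length (x ∷ w)
  lifted-closed⇒long {x} {w} {i , s} reduced closed =
    ≤∧≢⇒< (closed⇒long reduced (trans (sym (proj₁-act (x ∷ w) (i , s))) (cong proj₁ closed)))
          (λ L≡ → not-¬ refl (trans (sym bit-unchanged) (toggles-first reduced (sym L≡) s)))
    where
    bit-unchanged : lookup (proj₂ (act σ̂ (x ∷ w) (i , s))) (ℓ x i) ≡ lookup s (ℓ x i)
    bit-unchanged = cong (λ q → lookup (proj₂ q) (ℓ x i)) closed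

  lift : Matchings v (A × Vec Bool d) (suc L)
  lift = record
    { σ = σ̂
    ; σ-involutive = σ̂-involutive
    ; σ-fixpointFree = λ x p fixed → σ-fixpointFree x (proj₁ p) (cong proj₁ fixed)
    ; closed⇒long = lifted-closed⇒long
    }

bits↔ : ∀ d → Vec Bool d ↔ Fin (2 ^ d)
bits↔ zero = mk↔ₛ′ (λ _ → zero) (λ _ → []) (λ { zero → refl }) (λ { [] → refl })
bits↔ (suc d) = ↔-trans (mk↔ₛ′ uncons (uncurry _∷_) (λ _ → refl) (λ { (_ ∷ _) → refl }))
                        (↔-trans (↔-sym 2↔Bool ×-↔ bits↔ d) (↔-sym *↔×))

liftFin : ∀ {v m L} → Matchings v (Fin m) L → Matchings v (Fin (m * 2 ^ (v * m))) (suc L)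
liftFin {v} {m} M = transport (↔-trans (↔-refl ×-↔ bits↔ (v * m)) (↔-sym *↔×))
  (Lift.lift M combine (λ {x} {y} {i} {j} → combine-injective x i y j))

m<m*2^[v*m] : ∀ v m → 0 < v → 0 < m → m < m * 2 ^ (v * m)
m<m*2^[v*m] (suc v) (suc m) _ _ = m<m*n (suc m) _ (^-monoʳ-< 2 (s≤s (s≤s z≤n)) {0} {suc (m + v * suc m)} z<s)

matchings : ∀ {v} → 0 < v → ∀ t → Σ ℕ λ m → Matchings v (Fin m) (suc t) × t < m
matchings v>0 zero = 2 , swaps , s≤s z≤n
matchings {v} v>0 (suc t) with matchings v>0 t
... | m , M , t<m = m * 2 ^ (v * m) , liftFin M , <-≤-trans (s≤s t<m) (m<m*2^[v*m] v m v>0 (≤-<-trans z≤n t<m))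

-- Copies of a graph joined along matchings

-- Fin (m * v) is read as m copies of Fin v: combine i x is the vertex x of copy i.
module Copies (m v : ℕ) where

  copy : Fin (m * v) → Fin m
  copy a = proj₁ (remQuot {m} v a)

  vert : Fin (m * v) → Fin v
  vert a = proj₂ (remQuot {m} v a)

  copy-combine : ∀ i x → copy (combine i x) ≡ i
  copy-combine i x = cong proj₁ (remQuot-combine {m} {v} i x)

  vert-combine : ∀ i x → vert (combine i x) ≡ x
  vert-combine i x = cong proj₂ (remQuot-combine {m} {v} i x)

  combine-copy-vert : ∀ a → combine (copy a) (vert a) ≡ a
  combine-copy-vert = combine-remQuot {m} v

  copy-vert-injective : ∀ {a b} → copy a ≡ copy b → vert a ≡ vert b → a ≡ b
  copy-vert-injective {a} {b} c≡ v≡ =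
    trans (sym (combine-copy-vert a)) (trans (cong₂ combine c≡ v≡) (combine-copy-vert b))

  InCopy : Fin m → List (Fin (m * v)) → Set
  InCopy i = All (λ b → copy b ≡ i)

  InCopy⇒map-combine : ∀ {i} c → InCopy i c → c ≡ map (combine i) (map vert c)
  InCopy⇒map-combine [] [] = refl
  InCopy⇒map-combine (a ∷ c) (refl ∷ inCopy) =
    cong₂ _∷_ (sym (combine-copy-vert a)) (InCopy⇒map-combine c inCopy)

  countᵇ-allLists-copy : ∀ i l (p : List (Fin (m * v)) → Bool) →
    (∀ c → length c ≡ l → T (p c) → InCopy i c) →
    countᵇ p (allLists (m * v) l) ≡ countᵇ (p ∘ map (combine i)) (allLists v l)
  countᵇ-allLists-copy i zero p inCopy with p []
  ... | true  = refl
  ... | false = refl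
  countᵇ-allLists-copy i (suc l) p inCopy = begin
    countᵇ p (allLists (m * v) (suc l))
      ≡⟨ countᵇ-concatMap-tabulate p extend id ⟩
    sum (λ a → countᵇ p (extend a))
      ≡⟨ sum-cong-≗ (λ a → countᵇ-map p (a ∷_) (allLists (m * v) l)) ⟩
    sum startingAt
      ≡⟨ sum-combine m startingAt ⟩
    sum {m} (λ j → sum {v} (λ y → startingAt (combine j y)))
      ≡⟨ sum-single i (λ j j≢i → sum-zero (λ y → countᵇ-none (other-copy j y j≢i))) ⟩
    sum {v} (λ y → startingAt (combine i y))
      ≡⟨ sum-cong-≗ (λ y → countᵇ-allLists-copy i l (p ∘ (combine i y ∷_))
           (λ c len pc → All.tail (inCopy (combine i y ∷ c) (cong suc len) pc))) ⟩
    sum {v} (λ y → countᵇ (p ∘ map (combine i) ∘ (y ∷_)) (allLists v l))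
      ≡⟨ sum-cong-≗ (λ y → countᵇ-map (p ∘ map (combine i)) (y ∷_) (allLists v l)) ⟨
    sum {v} (λ y → countᵇ (p ∘ map (combine i)) (map (y ∷_) (allLists v l)))
      ≡⟨ countᵇ-concatMap-tabulate (p ∘ map (combine i)) (λ y → map (y ∷_) (allLists v l)) id ⟨
    countᵇ (p ∘ map (combine i)) (allLists v (suc l)) ∎
    where
    open ≡-Reasoning
    extend : Fin (m * v) → List (List (Fin (m * v)))
    extend a = map (a ∷_) (allLists (m * v) l)
    startingAt : Fin (m * v) → ℕ
    startingAt a = countᵇ (p ∘ (a ∷_)) (allLists (m * v) l)
    other-copy : ∀ j y → j ≢ i → All (λ c → ¬ T (p (combine j y ∷ c))) (allLists (m * v) l)
    other-copy j y j≢i = All.map (λ len pc → j≢i (trans (sym (copy-combine j y))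
      (All.head (inCopy (combine j y ∷ _) (cong suc len) pc)))) (allLists-length (m * v) l)

module Product {v m L : ℕ} (G : Graph v) (M : Matchings v (Fin m) L) where

  open Matchings M
  open Copies m v

  Across : Fin (m * v) → Fin (m * v) → Set
  Across a b = vert a ≡ vert b × σ (vert a) (copy a) ≡ copy b

  acrossᵇ : Fin (m * v) → Fin (m * v) → Bool
  acrossᵇ a b = vert a == vert b ∧ σ (vert a) (copy a) == copy b

  across-reflects : ∀ a b → Reflects (Across a b) (acrossᵇ a b)
  across-reflects a b = ==-reflects _ _ ×-reflects ==-reflects _ _

  Across-sym : ∀ {a b} → Across a b → Across b a
  Across-sym {a} (v≡ , c≡) = sym v≡ , trans (cong₂ σ (sym v≡) (sym c≡)) (σ-involutive (vert a) (copy a))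

  Across-functional : ∀ {a b c} → Across a b → Across a c → b ≡ c
  Across-functional (v≡b , c≡b) (v≡c , c≡c) = copy-vert-injective (trans (sym c≡b) c≡c) (trans (sym v≡b) v≡c)

  adjΓ : Fin (m * v) → Fin (m * v) → Bool
  adjΓ a b = if copy a == copy b then adj G (vert a) (vert b) else acrossᵇ a b

  adjΓ-sym : ∀ a b → adjΓ a b ≡ adjΓ b a
  adjΓ-sym a b rewrite ==-sym (copy b) (copy a) with copy a == copy b
  ... | true  = Graph.sym G (vert a) (vert b)
  ... | false = reflects-≡ (across-reflects a b) (across-reflects b a) Across-sym Across-sym

  adjΓ-irrefl : ∀ a → adjΓ a a ≡ false
  adjΓ-irrefl a rewrite ==-refl (copy a) = Graph.irrefl G (vert a)

  Γ : Graph (m * v)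
  Γ = record { adj = adjΓ ; sym = adjΓ-sym ; irrefl = adjΓ-irrefl }

  adjΓ-combine : ∀ i x j y →
    adjΓ (combine i x) (combine j y) ≡ (if i == j then adj G x y else (x == y ∧ σ x i == j))
  adjΓ-combine i x j y rewrite copy-combine i x | vert-combine i x | copy-combine j y | vert-combine j y = refl

  degree-row : ∀ i x j → sum (λ y → ind (adjΓ (combine i x) (combine j y))) ≡
                         indicator i (degree G x) j + indicator (σ x i) 1 j
  degree-row i x j = trans (sum-cong-≗ (λ y → cong ind (adjΓ-combine i x j y))) row
    where
    row : sum (λ y → ind (if i == j then adj G x y else (x == y ∧ σ x i == j))) ≡
          indicator i (degree G x) j + indicator (σ x i) 1 j
    row with i == j | ==-reflects i j
    ... | true | ofʸ refl rewrite ==-≢ (σ-fixpointFree x i) =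
      trans (sym (countᵇ-tabulate (adj G x) id)) (sym (+-identityʳ _))
    ... | false | ofⁿ _ = trans
      (sum-single x (λ y y≢x → cong (λ b → ind (b ∧ (σ x i == j))) (==-≢ (y≢x ∘ sym))))
      (cong (λ b → ind (b ∧ (σ x i == j))) (==-refl x))

  degree-combine : ∀ i x → degree Γ (combine i x) ≡ degree G x + 1
  degree-combine i x = begin
    degree Γ (combine i x)
      ≡⟨ countᵇ-tabulate (adjΓ (combine i x)) id ⟩
    sum (λ b → ind (adjΓ (combine i x) b))
      ≡⟨ sum-combine m _ ⟩
    sum {m} (λ j → sum {v} (λ y → ind (adjΓ (combine i x) (combine j y))))
      ≡⟨ sum-cong-≗ (degree-row i x) ⟩
    sum (λ j → indicator i (degree G x) j + indicator (σ x i) 1 j)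
      ≡⟨ ∑-distrib-+ (indicator i (degree G x)) (indicator (σ x i) 1) ⟩
    sum (indicator i (degree G x)) + sum (indicator (σ x i) 1)
      ≡⟨ cong₂ _+_ (sum-indicator i (degree G x)) (sum-indicator (σ x i) 1) ⟩
    degree G x + 1 ∎
    where open ≡-Reasoning

  Γ-regular : ∀ {k} → Regular G k → Regular Γ (suc k)
  Γ-regular {k} regular a = subst (λ b → degree Γ b ≡ suc k) (combine-copy-vert a) (begin
    degree Γ (combine (copy a) (vert a)) ≡⟨ degree-combine (copy a) (vert a) ⟩
    degree G (vert a) + 1                ≡⟨ cong (_+ 1) (regular (vert a)) ⟩
    k + 1                                ≡⟨ +-comm k 1 ⟩
    suc k                                ∎)
    where open ≡-Reasoning

  data Step (a b : Fin (m * v)) : Set where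
    inside : copy a ≡ copy b → Step a b
    across : Across a b → Step a b

  step : ∀ {a b} → T (adjΓ a b) → Step a b
  step {a} {b} t with copy a == copy b | ==-reflects (copy a) (copy b)
  ... | true  | ofʸ same = inside same
  ... | false | ofⁿ _ with acrossᵇ a b | across-reflects a b
  ...   | true | ofʸ ab = across ab

  colours : ∀ {q} → Linked Step q → List (Fin v)
  colours [] = []
  colours [-] = []
  colours (inside _ ∷ s) = colours s
  colours (_∷_ {a} (across _) s) = vert a ∷ colours s

  act-colours : ∀ {a r} (s : Linked Step (a ∷ r)) → act σ (colours s) (copy a) ≡ copy (lastOf a r)
  act-colours [-] = refl
  act-colours (inside same ∷ s) = trans (cong (act σ (colours s)) same) (act-colours s)
  act-colours (across (_ , moved) ∷ s) = trans (cong (act σ (colours s)) moved) (act-colours s)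

  length-colours : ∀ {a r} (s : Linked Step (a ∷ r)) → length (colours s) ≤ length r
  length-colours [-] = z≤n
  length-colours (inside _ ∷ s) = m≤n⇒m≤1+n (length-colours s)
  length-colours (across _ ∷ s) = s≤s (length-colours s)

  colours-[] : ∀ {a r} (s : Linked Step (a ∷ r)) → colours s ≡ [] → InCopy (copy a) r
  colours-[] [-] _ = []
  colours-[] (inside same ∷ s) none = sym same ∷ All.map (λ c≡ → trans c≡ (sym same)) (colours-[] s none)

  first-across : ∀ {a r y w} (s : Linked Step (a ∷ r)) → colours s ≡ y ∷ w → combine (copy a) y ∈ (a ∷ r)
  first-across (inside same ∷ s) first =
    there (subst (λ i → combine i _ ∈ _) (sym same) (first-across s first))
  first-across (across _ ∷ s) refl = here (combine-copy-vert _)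

  -- Two consecutive equal colours force the walk back onto an earlier vertex.
  across-then-same : ∀ {a b r w} → Across a b → Unique (b ∷ r) → (s : Linked Step (b ∷ r)) →
    colours s ≡ vert a ∷ w → Σ (List (Fin (m * v))) λ r′ → r ≡ a ∷ r′
  across-then-same ab (b∉r ∷ _) (inside same ∷ s) first = ⊥-elim (All¬⇒¬Any b∉r
    (subst (_∈ _) (copy-vert-injective (trans (copy-combine _ _) (sym same)) (trans (vert-combine _ _) (proj₁ ab)))
      (first-across s first)))
  across-then-same ab _ (_∷_ {y = c} {xs = r′} (across bc) s) _ =
    r′ , cong (_∷ r′) (Across-functional bc (Across-sym ab))

  reduced-after-across : ∀ {a b r} → Across a b → Unique (b ∷ r) → (∀ {r′} → r ≢ a ∷ r′) →
    (s : Linked Step (b ∷ r)) → Linked _≢_ (colours s) → Linked _≢_ (vert a ∷ colours s)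
  reduced-after-across ab u no-return s reduced with colours s in eq
  ... | [] = [-]
  ... | y ∷ w = (λ { refl → no-return (proj₂ (across-then-same ab u s eq)) }) ∷ reduced

  colours-reduced : ∀ {a r} → Unique (a ∷ r) → (s : Linked Step (a ∷ r)) → Linked _≢_ (colours s)
  colours-reduced _ [-] = []
  colours-reduced (_ ∷ u) (inside _ ∷ s) = colours-reduced u s
  colours-reduced ((a≢b ∷ a∉r) ∷ u) (across ab ∷ s) =
    reduced-after-across ab u (λ { refl → All.head a∉r refl }) s (colours-reduced u s)

  -- Only the rotated walk has distinct vertices; a₀ ≢ a₂ rules out a first step that
  -- the second one undoes.
  closed-colours-reduced : ∀ {a₀ a₁ a₂ r} → Unique (a₀ ∷ a₁ ∷ a₂ ∷ r) →
    (s : Linked Step (a₀ ∷ a₁ ∷ a₂ ∷ r ++ [ a₀ ])) → Linked _≢_ (colours s)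
  closed-colours-reduced u (inside _ ∷ s) = colours-reduced (Unique-rotate u) s
  closed-colours-reduced u@((_ ∷ a₀≢a₂ ∷ _) ∷ _) (across ab ∷ s) =
    reduced-after-across ab (Unique-rotate u) (λ { refl → a₀≢a₂ refl }) s (colours-reduced (Unique-rotate u) s)

  closed-walk-in-copy-or-long : ∀ {a₀ a₁ a₂ r} → Unique (a₀ ∷ a₁ ∷ a₂ ∷ r) →
    (s : Linked Step (a₀ ∷ a₁ ∷ a₂ ∷ r ++ [ a₀ ])) →
    InCopy (copy a₀) (a₀ ∷ a₁ ∷ a₂ ∷ r) ⊎ L ≤ length (a₀ ∷ a₁ ∷ a₂ ∷ r)
  closed-walk-in-copy-or-long {a₀} {a₁} {a₂} {r} u s
    with colours s in eq | closed-colours-reduced u s | act-colours s | length-colours s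
  ... | [] | _ | _ | _ = inj₁ (refl ∷ ++⁻ˡ (a₁ ∷ a₂ ∷ r) (colours-[] s eq))
  ... | y ∷ w | reduced | closes | short = inj₂ (≤-trans
    (closed⇒long reduced (trans closes (cong copy (lastOf-++ a₁ (a₂ ∷ r) a₀))))
    (subst (length (y ∷ w) ≤_) (length-++-[ a₀ ] (a₁ ∷ a₂ ∷ r)) short))

  cycle-in-copy-or-long : ∀ c → T (isCycleᵇ Γ c) → (Σ (Fin m) λ i → InCopy i c) ⊎ L ≤ length c
  cycle-in-copy-or-long c@(a₀ ∷ a₁ ∷ a₂ ∷ r) t =
    Sum.map₁ (copy a₀ ,_) (closed-walk-in-copy-or-long (cycle⇒Unique Γ c t)
      (Linked.map step (cycle⇒Walk Γ a₀ (a₁ ∷ a₂ ∷ r) t)))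

  adjΓ-copy : ∀ i x y → adjΓ (combine i x) (combine i y) ≡ adj G x y
  adjΓ-copy i x y =
    trans (adjΓ-combine i x i y) (cong (if_then adj G x y else (x == y ∧ σ x i == i)) (==-refl i))

  module CopyEmbedding (i : Fin m) =
    Embedding {G = G} {H = Γ} (combine i) (v * toℕ i) (toℕ-combine i) (adjΓ-copy i)

  cycle-in-copy : ∀ {i} c → InCopy i c → T (isCycleᵇ Γ c) → T (isCycleᵇ G (map vert c))
  cycle-in-copy {i} c inCopy = subst T
    (trans (cong (isCycleᵇ Γ) (InCopy⇒map-combine c inCopy)) (CopyEmbedding.isCycleᵇ-φ i (map vert c)))

  Γ-girth : ∀ {g} → g < L → Fin m → HasGirth G g → HasGirth Γ g
  Γ-girth {g} g<L i ((c , len , cyc) , long) =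
    (map (combine i) c , trans (length-map _ c) len , subst T (sym (CopyEmbedding.isCycleᵇ-φ i c)) cyc) , longΓ
    where
    longΓ : ∀ c → T (isCycleᵇ Γ c) → g ≤ length c
    longΓ c t with cycle-in-copy-or-long c t
    ... | inj₁ (_ , inCopy) = subst (g ≤_) (length-map vert c) (long (map vert c) (cycle-in-copy c inCopy t))
    ... | inj₂ L≤length = ≤-trans (<⇒≤ g<L) L≤length

  Γ-cyclesThrough : ∀ {g} → g < L → ∀ i x → cyclesThrough Γ g (combine i x) ≡ cyclesThrough G g x
  Γ-cyclesThrough {g} g<L i x = trans (countᵇ-allLists-copy i g _ g-cycles-in-copy)
    (countᵇ-cong (CopyEmbedding.cycleThroughᵇ-φ i x) (allLists v g))
    where
    g-cycles-in-copy : ∀ c → length c ≡ g → T (cycleThroughᵇ Γ (combine i x) c) → InCopy i c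
    g-cycles-in-copy c len t with cycle-in-copy-or-long c (cycleThrough⇒isCycle Γ (combine i x) c t)
    ... | inj₂ long = ⊥-elim (<⇒≱ g<L (subst (L ≤_) len long))
    ... | inj₁ (j , inCopy) = subst (λ j → InCopy j c)
      (trans (sym (All.lookup inCopy (cycleThrough⇒∈ Γ (combine i x) c t))) (copy-combine i x)) inCopy

  Γ-VGR : ∀ {k g lam} → g < L → Fin m →
    Regular G k → HasGirth G g → (∀ x → cyclesThrough G g x ≡ lam) → VGR (m * v) (suc k) g lam
  Γ-VGR {g = g} {lam} g<L i regular girth cycles =
    Γ , Γ-regular regular , Γ-girth g<L i girth , λ a →
      subst (λ a → cyclesThrough Γ g a ≡ lam) (combine-copy-vert a)
        (trans (Γ-cyclesThrough g<L (copy a) (vert a)) (cycles (vert a)))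

proposition2 : (v k g lam : ℕ) → VGR v k g lam →
    (N : ℕ) → Σ ℕ (λ v′ → N ≤ v′ × VGR v′ (suc k) g lam)
proposition2 v k g lam (G , regular , girth , cycles) N
  with matchings (hasGirth⇒0< girth) (g + N)
... | m , M , g+N<m = m * v , N≤m*v , Product.Γ-VGR G M (s≤s (m≤m+n g N)) i₀ regular girth cycles
  where
  i₀ : Fin m
  i₀ = fromℕ< g+N<m
  N≤m*v : N ≤ m * v
  N≤m*v = ≤-trans (m≤n+m N g) (≤-trans (<⇒≤ g+N<m) (m≤m*n m v {{>-nonZero (hasGirth⇒0< girth)}}))
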